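{- Let $p$ be a prime, $n,m\in\mathbb{N}$, $0\le i\le n$ and $d\in U_1$. Then $$\mathrm{ann}_{R_mG_i}(\sigma-d)=\langle p^kQ_d(i,0)\rangle,$$ where $k=\min\{v\ge0: p^v(d^{p^i}-1)\equiv0\pmod{p^m}\}$.
   Context: $G$ is cyclic of order $p^n$ with generator $\sigma$; $G_i$ its quotient of order $p^i$ (image of $\sigma$ still written $\sigma$). $R_m=\mathbb{Z}/p^m\mathbb{Z}$; $d$ acts via its image in $R_m$. $U_1=1+p\mathbb{Z}$. For $0\le j\le i$, $Q_d(i,j)=\sum_{k=0}^{p^{i-j}-1}(d^{p^j})^{p^{i-j}-1-k}(\sigma^{p^j})^k$. $\langle\cdot\rangle$ denotes the ideal generated. -}

module Defs where

open import Data.Nat using (ℕ; zero; suc; _≡ᵇ_) renaming (_+_ to _+ℕ_)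
open import Data.Nat.DivMod using (_%_)
open import Data.Integer using (ℤ; +_; _+_; _-_; _*_; -_; 0ℤ; 1ℤ; _^_)
open import Data.Integer.Divisibility using (_∣_)
open import Data.Bool using (if_then_else_)
open import Data.Product using (∃)

_mod'_ : ℕ → ℕ → ℕ
e mod' zero = 0
e mod' suc k = e % suc k

Σ< : ℕ → (ℕ → ℤ) → ℤ
Σ< zero f = 0ℤ
Σ< (suc n) f = Σ< n f + f n

-- An element of the group ring R_m G_i (G_i cyclic of order N = p^i, generator σ)
-- is represented by its coefficient function: x j = coefficient of σ^j, j < N.
-- Coefficients are integers, read modulo M = p^m.
Elem : Set
Elem = ℕ → ℤ

Eq : (M N : ℕ) → Elem → Elem → Set
Eq M N x y = ∀ j → Data.Nat._<_ j N → (+ M) ∣ (x j - y j)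

_⊕_ : Elem → Elem → Elem
(x ⊕ y) j = x j + y j

_·_ : ℤ → Elem → Elem
(c · x) j = c * x j

-- multiplication in the cyclic group ring of order N (σ^s σ^t = σ^((s+t) mod N))
mul : (N : ℕ) → Elem → Elem → Elem
mul N x y j = Σ< N (λ s → Σ< N (λ t →
  if ((s +ℕ t) mod' N) ≡ᵇ j then x s * y t else 0ℤ))

mono : (N : ℕ) → ℕ → ℤ → Elem
mono N e c j = if (e mod' N) ≡ᵇ j then c else 0ℤ

σ-minus : (N : ℕ) → ℤ → Elem
σ-minus N d = mono N 1 1ℤ ⊕ mono N 0 (- d)

Q0 : (N : ℕ) → ℤ → Elem
Q0 N d = λ j → if Data.Nat._<ᵇ_ j N then d ^ (Data.Nat._∸_ (Data.Nat._∸_ N 1) j) else 0ℤ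

Ann : (M N : ℕ) → Elem → Elem → Set
Ann M N a x = Eq M N (mul N x a) (λ _ → 0ℤ)

InIdeal : (M N : ℕ) → Elem → Elem → Set
InIdeal M N g x = ∃ λ y → Eq M N x (mul N y g)

-- Write N = p^i and M = p^m.  Coefficientwise, x (σ - d) = 0 says x_{j-1} ≡ d x_j (indices mod N),
-- so an annihilator is determined by its top coefficient: x_j ≡ d^(n-j) x_n for N = n + 1, i.e.
-- x = x_n Q_d(i,0).  Going once around the cycle gives (d^N - 1) x_n ≡ 0 mod M, and minimality
-- of k forces p^k ∣ x_n.  Conversely p^k Q_d(i,0) satisfies the recurrence exactly because
-- p^k (d^N - 1) ≡ 0, and the recurrence is preserved by multiplication in the group ring.
module Submission where

open import Defs
open import Data.Nat using (ℕ; zero; suc; z≤n; s≤s; _≤_; _<_; _≡ᵇ_; _∸_; NonZero)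
  renaming (_^_ to _^ℕ_; _+_ to _+ℕ_; _*_ to _*ℕ_)
import Data.Nat.Properties as ℕ
open import Data.Nat.DivMod
  using (_%_; %-distribˡ-+; m%n%n≡m%n; [m+n]%n≡m%n; m<n⇒m%n≡m; m%n<n; n%n≡0)
import Data.Nat.Divisibility as ℕ
open import Data.Nat.Primality using (Prime; euclidsLemma; prime⇒nonZero)
open import Data.Nat.Tactic.RingSolver as ℕ-Solver using ()
open import Data.Integer using (ℤ; +_; _+_; _-_; _*_; -_; _^_; 0ℤ; 1ℤ)
import Data.Integer.Properties as ℤ
open import Algebra.Properties.CommutativeSemigroup ℤ.*-commutativeSemigroup using (x∙yz≈y∙xz)
open import Data.Integer.Divisibility using (_∣_)
import Data.Integer.Divisibility.Signed as Signed
open import Data.Integer.Tactic.RingSolver using (solve-∀)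
open import Data.Bool using (true; false; if_then_else_; T)
open import Data.Unit using (tt)
open import Data.Empty using (⊥-elim)
open import Data.Product using (_×_; _,_)
open import Data.Sum using (inj₁; inj₂)
open import Function using (_∘_)
open import Relation.Nullary using (¬_; yes; no)
open import Relation.Binary using (IsEquivalence; Setoid)
open import Relation.Binary.PropositionalEquality
import Relation.Binary.Reasoning.Setoid as SetoidReasoning

if-T : ∀ {b} {u v : ℤ} → T b → (if b then u else v) ≡ u
if-T {true} _ = refl

if-¬T : ∀ {b} {u v : ℤ} → ¬ T b → (if b then u else v) ≡ v
if-¬T {true} ¬t = ⊥-elim (¬t tt)
if-¬T {false} _ = refl

if-≡ᵇ-yes : ∀ {a b} {u v : ℤ} → a ≡ b → (if a ≡ᵇ b then u else v) ≡ u
if-≡ᵇ-yes {a} {b} a≡b = if-T (ℕ.≡⇒≡ᵇ a b a≡b)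

if-≡ᵇ-no : ∀ {a b} {u v : ℤ} → a ≢ b → (if a ≡ᵇ b then u else v) ≡ v
if-≡ᵇ-no {a} {b} a≢b = if-¬T (a≢b ∘ ℕ.≡ᵇ⇒≡ a b)

Σ<-cong : ∀ N {f g : ℕ → ℤ} → (∀ s → s < N → f s ≡ g s) → Σ< N f ≡ Σ< N g
Σ<-cong zero    f≡g = refl
Σ<-cong (suc N) f≡g = cong₂ _+_ (Σ<-cong N (λ s → f≡g s ∘ ℕ.m<n⇒m<1+n)) (f≡g N ℕ.≤-refl)

Σ<-zero : ∀ N {f : ℕ → ℤ} → (∀ s → s < N → f s ≡ 0ℤ) → Σ< N f ≡ 0ℤ
Σ<-zero N f≡0 = trans (Σ<-cong N f≡0) (zeros N)
  where
  zeros : ∀ N → Σ< N (λ _ → 0ℤ) ≡ 0ℤ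
  zeros zero    = refl
  zeros (suc N) = trans (ℤ.+-identityʳ _) (zeros N)

Σ<-single : ∀ N {f : ℕ → ℤ} s₀ → s₀ < N → (∀ s → s < N → s ≢ s₀ → f s ≡ 0ℤ) → Σ< N f ≡ f s₀
Σ<-single (suc N) {f} s₀ s₀<1+N f≡0 with ℕ.m≤n⇒m<n∨m≡n (ℕ.≤-pred s₀<1+N)
... | inj₁ s₀<N = begin
  Σ< N f + f N  ≡⟨ cong₂ _+_ (Σ<-single N s₀ s₀<N (λ s → f≡0 s ∘ ℕ.m<n⇒m<1+n))
                             (f≡0 N ℕ.≤-refl (λ N≡s₀ → ℕ.<-irrefl (sym N≡s₀) s₀<N)) ⟩
  f s₀ + 0ℤ     ≡⟨ ℤ.+-identityʳ (f s₀) ⟩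
  f s₀          ∎
  where open ≡-Reasoning
... | inj₂ refl = begin
  Σ< N f + f N  ≡⟨ cong (_+ f N) (Σ<-zero N (λ s s<N → f≡0 s (ℕ.m<n⇒m<1+n s<N) (ℕ.<⇒≢ s<N))) ⟩
  0ℤ + f N      ≡⟨ ℤ.+-identityˡ (f N) ⟩
  f N           ∎
  where open ≡-Reasoning

Σ<-+ : ∀ N (f g : ℕ → ℤ) → Σ< N (λ s → f s + g s) ≡ Σ< N f + Σ< N g
Σ<-+ zero    f g = refl
Σ<-+ (suc N) f g = trans (cong (_+ (f N + g N)) (Σ<-+ N f g)) (+-interchange (Σ< N f) (Σ< N g) (f N) (g N))
  where
  +-interchange : ∀ a b u v → (a + b) + (u + v) ≡ (a + u) + (b + v)
  +-interchange = solve-∀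

Σ<-*ˡ : ∀ N (c : ℤ) (f : ℕ → ℤ) → c * Σ< N f ≡ Σ< N (λ s → c * f s)
Σ<-*ˡ zero    c f = ℤ.*-zeroʳ c
Σ<-*ˡ (suc N) c f = trans (ℤ.*-distribˡ-+ c (Σ< N f) (f N)) (cong (_+ c * f N) (Σ<-*ˡ N c f))

module Congruence (M : ℕ) where

  -- A record rather than a synonym, so that a and b can be inferred from a proof of a ≋ b.
  infix 4 _≋_
  record _≋_ (a b : ℤ) : Set where
    constructor mk≋
    field ∣-diff : + M Signed.∣ a - b
  open _≋_ public

  ≋-fromᵤ : ∀ {a b} → + M ∣ a - b → a ≋ b
  ≋-fromᵤ M∣a-b = mk≋ (Signed.∣ᵤ⇒∣ M∣a-b)

  ≋-toᵤ : ∀ {a b} → a ≋ b → + M ∣ a - b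
  ≋-toᵤ a≋b = Signed.∣⇒∣ᵤ (∣-diff a≋b)

  ≋-reflexive : ∀ {a b} → a ≡ b → a ≋ b
  ≋-reflexive {a} refl = mk≋ (Signed.divides 0ℤ (trans (ℤ.+-inverseʳ a) (sym (ℤ.*-zeroˡ (+ M)))))

  ≋-sym : ∀ {a b} → a ≋ b → b ≋ a
  ≋-sym {a} {b} (mk≋ M∣a-b) = mk≋ (subst (+ M Signed.∣_) (negate a b) (Signed.∣m⇒∣-m M∣a-b))
    where
    negate : ∀ a b → - (a - b) ≡ b - a
    negate = solve-∀

  ≋-trans : ∀ {a b c} → a ≋ b → b ≋ c → a ≋ c
  ≋-trans {a} {b} {c} (mk≋ M∣a-b) (mk≋ M∣b-c) =
    mk≋ (subst (+ M Signed.∣_) (telescope a b c) (Signed.∣m∣n⇒∣m+n M∣a-b M∣b-c))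
    where
    telescope : ∀ a b c → (a - b) + (b - c) ≡ a - c
    telescope = solve-∀

  ≋-isEquivalence : IsEquivalence _≋_
  ≋-isEquivalence = record { refl = ≋-reflexive refl ; sym = ≋-sym ; trans = ≋-trans }

  ≋-setoid : Setoid _ _
  ≋-setoid = record { isEquivalence = ≋-isEquivalence }

  +-cong-≋ : ∀ {a b c e} → a ≋ b → c ≋ e → a + c ≋ b + e
  +-cong-≋ {a} {b} {c} {e} (mk≋ M∣a-b) (mk≋ M∣c-e) =
    mk≋ (subst (+ M Signed.∣_) (interchange a b c e) (Signed.∣m∣n⇒∣m+n M∣a-b M∣c-e))
    where
    interchange : ∀ a b c e → (a - b) + (c - e) ≡ (a + c) - (b + e)
    interchange = solve-∀

  *-congˡ-≋ : ∀ c {a b} → a ≋ b → c * a ≋ c * b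
  *-congˡ-≋ c {a} {b} (mk≋ M∣a-b) = mk≋ (subst (+ M Signed.∣_) (distrib c a b) (Signed.∣n⇒∣m*n c M∣a-b))
    where
    distrib : ∀ c a b → c * (a - b) ≡ c * a - c * b
    distrib = solve-∀

  ≋0⇒∣ : ∀ {a} → a ≋ 0ℤ → + M Signed.∣ a
  ≋0⇒∣ {a} (mk≋ M∣a-0) = subst (+ M Signed.∣_) (ℤ.+-identityʳ a) M∣a-0

  ∣⇒≋0 : ∀ {a} → + M Signed.∣ a → a ≋ 0ℤ
  ∣⇒≋0 {a} M∣a = mk≋ (subst (+ M Signed.∣_) (sym (ℤ.+-identityʳ a)) M∣a)

  -≋0⇒≋ : ∀ {a b} → a - b ≋ 0ℤ → a ≋ b
  -≋0⇒≋ = mk≋ ∘ ≋0⇒∣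

  ≋⇒-≋0 : ∀ {a b} → a ≋ b → a - b ≋ 0ℤ
  ≋⇒-≋0 = ∣⇒≋0 ∘ ∣-diff

  Σ<-cong-≋ : ∀ N {f g : ℕ → ℤ} → (∀ s → s < N → f s ≋ g s) → Σ< N f ≋ Σ< N g
  Σ<-cong-≋ zero    f≋g = ≋-reflexive refl
  Σ<-cong-≋ (suc N) f≋g = +-cong-≋ (Σ<-cong-≋ N (λ s → f≋g s ∘ ℕ.m<n⇒m<1+n)) (f≋g N ℕ.≤-refl)

-- Index arithmetic in the cyclic group of order N = suc n, with j ⊖ s the exponent of σ^j σ^(-s).
module Cyclic (n : ℕ) where

  N : ℕ
  N = suc n

  infixl 6 _⊖_
  _⊖_ : ℕ → ℕ → ℕ
  j ⊖ s = (j +ℕ (N ∸ s)) % N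

  ⊖-< : ∀ j s → j ⊖ s < N
  ⊖-< j s = m%n<n (j +ℕ (N ∸ s)) N

  %-absorbˡ : ∀ a b → (a % N +ℕ b) % N ≡ (a +ℕ b) % N
  %-absorbˡ a b = begin
    (a % N +ℕ b) % N         ≡⟨ %-distribˡ-+ (a % N) b N ⟩
    (a % N % N +ℕ b % N) % N ≡⟨ cong (λ u → (u +ℕ b % N) % N) (m%n%n≡m%n a N) ⟩
    (a % N +ℕ b % N) % N     ≡⟨ %-distribˡ-+ a b N ⟨
    (a +ℕ b) % N             ∎
    where open ≡-Reasoning

  %-absorbʳ : ∀ a b → (a +ℕ b % N) % N ≡ (a +ℕ b) % N
  %-absorbʳ a b = begin
    (a +ℕ b % N) % N ≡⟨ cong (_% N) (ℕ.+-comm a (b % N)) ⟩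
    (b % N +ℕ a) % N ≡⟨ %-absorbˡ b a ⟩
    (b +ℕ a) % N     ≡⟨ cong (_% N) (ℕ.+-comm b a) ⟩
    (a +ℕ b) % N     ∎
    where open ≡-Reasoning

  +-⊖ : ∀ {j s} → s ≤ N → j < N → (s +ℕ (j ⊖ s)) % N ≡ j
  +-⊖ {j} {s} s≤N j<N = begin
    (s +ℕ (j ⊖ s)) % N               ≡⟨ cong (_% N) (ℕ.+-comm s (j ⊖ s)) ⟩
    ((j ⊖ s) +ℕ s) % N               ≡⟨ %-absorbˡ (j +ℕ (N ∸ s)) s ⟩
    (j +ℕ (N ∸ s) +ℕ s) % N        ≡⟨ cong (_% N) (ℕ.+-assoc j (N ∸ s) s) ⟩
    (j +ℕ (N ∸ s +ℕ s)) % N        ≡⟨ cong (λ u → (j +ℕ u) % N) (ℕ.m∸n+n≡m s≤N) ⟩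
    (j +ℕ N) % N                   ≡⟨ [m+n]%n≡m%n j N ⟩
    j % N                          ≡⟨ m<n⇒m%n≡m j<N ⟩
    j                              ∎
    where open ≡-Reasoning

  ⊖-unique : ∀ {j s t} → s ≤ N → t < N → (s +ℕ t) % N ≡ j → j ⊖ s ≡ t
  ⊖-unique {j} {s} {t} s≤N t<N s+t≡j = begin
    (j +ℕ (N ∸ s)) % N             ≡⟨ cong (λ u → (u +ℕ (N ∸ s)) % N) s+t≡j ⟨
    ((s +ℕ t) % N +ℕ (N ∸ s)) % N  ≡⟨ %-absorbˡ (s +ℕ t) (N ∸ s) ⟩
    (s +ℕ t +ℕ (N ∸ s)) % N        ≡⟨ cong (λ u → (u +ℕ (N ∸ s)) % N) (ℕ.+-comm s t) ⟩
    (t +ℕ s +ℕ (N ∸ s)) % N        ≡⟨ cong (_% N) (ℕ.+-assoc t s (N ∸ s)) ⟩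
    (t +ℕ (s +ℕ (N ∸ s))) % N      ≡⟨ cong (λ u → (t +ℕ u) % N) (ℕ.m+[n∸m]≡n s≤N) ⟩
    (t +ℕ N) % N                   ≡⟨ [m+n]%n≡m%n t N ⟩
    t % N                          ≡⟨ m<n⇒m%n≡m t<N ⟩
    t                              ∎
    where open ≡-Reasoning

  ⊖-involutive : ∀ {j s} → j < N → s < N → j ⊖ (j ⊖ s) ≡ s
  ⊖-involutive {j} {s} j<N s<N =
    ⊖-unique (ℕ.<⇒≤ (⊖-< j s)) s<N (trans (cong (_% N) (ℕ.+-comm (j ⊖ s) s)) (+-⊖ (ℕ.<⇒≤ s<N) j<N))

  ⊖-identityʳ : ∀ {j} → j < N → j ⊖ 0 ≡ j
  ⊖-identityʳ {j} j<N = trans ([m+n]%n≡m%n j N) (m<n⇒m%n≡m j<N)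

  -- 1 % N rather than 1, so that pred matches the exponent of σ in σ-minus even when N = 1.
  pred : ℕ → ℕ
  pred j = j ⊖ 1 % N

  1%N≤N : 1 % N ≤ N
  1%N≤N = ℕ.<⇒≤ (m%n<n 1 N)

  pred-suc : ∀ {j} → suc j < N → pred (suc j) ≡ j
  pred-suc {j} 1+j<N = ⊖-unique 1%N≤N (ℕ.<-trans (ℕ.n<1+n j) 1+j<N) (trans (%-absorbˡ 1 j) (m<n⇒m%n≡m 1+j<N))

  pred-zero : pred 0 ≡ n
  pred-zero = ⊖-unique 1%N≤N ℕ.≤-refl (trans (%-absorbˡ 1 n) (n%n≡0 N))

  pred-⊖ : ∀ {j s} → j < N → s < N → pred j ⊖ s ≡ pred (j ⊖ s)
  pred-⊖ {j} {s} j<N s<N = ⊖-unique (ℕ.<⇒≤ s<N) (⊖-< u (1 % N)) (sym pred-j≡s+pred-u)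
    where
    u = j ⊖ s
    open ≡-Reasoning
    +-left-comm : ∀ a b c → a +ℕ (b +ℕ c) ≡ b +ℕ (a +ℕ c)
    +-left-comm = ℕ-Solver.solve-∀
    pred-j≡s+pred-u : pred j ≡ (s +ℕ pred u) % N
    pred-j≡s+pred-u = ⊖-unique 1%N≤N (m%n<n (s +ℕ pred u) N) (begin
      (1 % N +ℕ (s +ℕ pred u) % N) % N ≡⟨ %-absorbʳ (1 % N) (s +ℕ pred u) ⟩
      (1 % N +ℕ (s +ℕ pred u)) % N     ≡⟨ cong (_% N) (+-left-comm (1 % N) s (pred u)) ⟩
      (s +ℕ (1 % N +ℕ pred u)) % N     ≡⟨ %-absorbʳ s (1 % N +ℕ pred u) ⟨
      (s +ℕ (1 % N +ℕ pred u) % N) % N ≡⟨ cong (λ v → (s +ℕ v) % N) (+-⊖ 1%N≤N (⊖-< j s)) ⟩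
      (s +ℕ u) % N                     ≡⟨ +-⊖ (ℕ.<⇒≤ s<N) j<N ⟩
      j                                ∎)

module GroupRing (n : ℕ) where
  open Cyclic n

  mul-apply : ∀ x y {j} → j < N → mul N x y j ≡ Σ< N (λ s → x s * y (j ⊖ s))
  mul-apply x y {j} j<N = Σ<-cong N column
    where
    column : ∀ s → s < N →
      Σ< N (λ t → if (s +ℕ t) % N ≡ᵇ j then x s * y t else 0ℤ) ≡ x s * y (j ⊖ s)
    column s s<N = trans
      (Σ<-single N (j ⊖ s) (⊖-< j s) (λ t t<N t≢j⊖s →
        if-≡ᵇ-no (λ s+t≡j → t≢j⊖s (sym (⊖-unique (ℕ.<⇒≤ s<N) t<N s+t≡j)))))
      (if-≡ᵇ-yes (+-⊖ (ℕ.<⇒≤ s<N) j<N))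

  mul-mono : ∀ x e c {j} → j < N → mul N x (mono N e c) j ≡ x (j ⊖ e % N) * c
  mul-mono x e c {j} j<N = begin
    mul N x (mono N e c) j                    ≡⟨ mul-apply x (mono N e c) j<N ⟩
    Σ< N (λ s → x s * mono N e c (j ⊖ s))     ≡⟨ Σ<-single N (j ⊖ e % N) (⊖-< j (e % N)) vanish ⟩
    x (j ⊖ e % N) * mono N e c (j ⊖ (j ⊖ e % N))
      ≡⟨ cong (x (j ⊖ e % N) *_) (if-≡ᵇ-yes (sym (⊖-involutive j<N (m%n<n e N)))) ⟩
    x (j ⊖ e % N) * c                         ∎
    where
    open ≡-Reasoning
    vanish : ∀ s → s < N → s ≢ j ⊖ e % N → x s * mono N e c (j ⊖ s) ≡ 0ℤ
    vanish s s<N s≢ = trans (cong (x s *_) (if-≡ᵇ-no (λ e≡j⊖s →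
        s≢ (trans (sym (⊖-involutive j<N s<N)) (cong (j ⊖_) {j ⊖ s} {e % N} (sym e≡j⊖s))))))
      (ℤ.*-zeroʳ (x s))

  mono₀-mul : ∀ c y {j} → j < N → mul N (mono N 0 c) y j ≡ c * y j
  mono₀-mul c y {j} j<N =
    trans (mul-apply (mono N 0 c) y j<N)
      (trans (Σ<-single N 0 (s≤s z≤n) vanish) (cong (λ t → c * y t) (⊖-identityʳ j<N)))
    where
    vanish : ∀ s → s < N → s ≢ 0 → mono N 0 c s * y (j ⊖ s) ≡ 0ℤ
    vanish zero    _ 0≢0 = ⊥-elim (0≢0 refl)
    vanish (suc s) _ _   = refl

  mul-⊕ʳ : ∀ x y z {j} → j < N → mul N x (y ⊕ z) j ≡ mul N x y j + mul N x z j
  mul-⊕ʳ x y z {j} j<N = begin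
    mul N x (y ⊕ z) j                                   ≡⟨ mul-apply x (y ⊕ z) j<N ⟩
    Σ< N (λ s → x s * (y (j ⊖ s) + z (j ⊖ s)))         ≡⟨ Σ<-cong N (λ s _ → ℤ.*-distribˡ-+ (x s) _ _) ⟩
    Σ< N (λ s → x s * y (j ⊖ s) + x s * z (j ⊖ s))     ≡⟨ Σ<-+ N _ _ ⟩
    Σ< N (λ s → x s * y (j ⊖ s)) + Σ< N (λ s → x s * z (j ⊖ s))
      ≡⟨ cong₂ _+_ (mul-apply x y j<N) (mul-apply x z j<N) ⟨
    mul N x y j + mul N x z j                           ∎
    where open ≡-Reasoning

  mul-σ-minus : ∀ x d {j} → j < N → mul N x (σ-minus N d) j ≡ x (pred j) - d * x j
  mul-σ-minus x d {j} j<N = begin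
    mul N x (σ-minus N d) j                              ≡⟨ mul-⊕ʳ x _ _ j<N ⟩
    mul N x (mono N 1 1ℤ) j + mul N x (mono N 0 (- d)) j ≡⟨ cong₂ _+_ (mul-mono x 1 1ℤ j<N) (mul-mono x 0 (- d) j<N) ⟩
    x (pred j) * 1ℤ + x (j ⊖ 0) * - d                    ≡⟨ cong (λ t → x (pred j) * 1ℤ + x t * - d) (⊖-identityʳ j<N) ⟩
    x (pred j) * 1ℤ + x j * - d                          ≡⟨ normalise (x (pred j)) (x j) d ⟩
    x (pred j) - d * x j                                 ∎
    where
    open ≡-Reasoning
    normalise : ∀ a b d → a * 1ℤ + b * - d ≡ a - d * b
    normalise = solve-∀

  Q0-apply : ∀ d {j} → j < N → Q0 N d j ≡ d ^ (n ∸ j)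
  Q0-apply d j<N = if-T (ℕ.<⇒<ᵇ j<N)

-- Eigen x is x σ ≡ d x read off coefficientwise.
module Eigen (M n : ℕ) (d : ℤ) where
  open Cyclic n
  open GroupRing n
  open Congruence M
  open SetoidReasoning ≋-setoid

  Eigen : Elem → Set
  Eigen x = ∀ j → j < N → x (pred j) ≋ d * x j

  ann⇒eigen : ∀ x → Ann M N (σ-minus N d) x → Eigen x
  ann⇒eigen x ann j j<N = -≋0⇒≋ (subst (_≋ 0ℤ) (mul-σ-minus x d j<N) (≋-fromᵤ (ann j j<N)))

  eigen⇒ann : ∀ x → Eigen x → Ann M N (σ-minus N d) x
  eigen⇒ann x eigen j j<N = ≋-toᵤ (subst (_≋ 0ℤ) (sym (mul-σ-minus x d j<N)) (≋⇒-≋0 (eigen j j<N)))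

  eigen-resp : ∀ x y → Eq M N x y → Eigen y → Eigen x
  eigen-resp x y x≈y eigen j j<N = begin
    x (pred j) ≈⟨ ≋-fromᵤ (x≈y (pred j) (⊖-< j (1 % N))) ⟩
    y (pred j) ≈⟨ eigen j j<N ⟩
    d * y j    ≈⟨ *-congˡ-≋ d (≋-fromᵤ (x≈y j j<N)) ⟨
    d * x j    ∎

  eigen-mulˡ : ∀ y g → Eigen g → Eigen (mul N y g)
  eigen-mulˡ y g eigen j j<N = begin
    mul N y g (pred j)                       ≡⟨ mul-apply y g (⊖-< j (1 % N)) ⟩
    Σ< N (λ s → y s * g (pred j ⊖ s))        ≡⟨ Σ<-cong N (λ s s<N → cong (λ t → y s * g t) (pred-⊖ j<N s<N)) ⟩
    Σ< N (λ s → y s * g (pred (j ⊖ s)))      ≈⟨ Σ<-cong-≋ N (λ s _ → *-congˡ-≋ (y s) (eigen (j ⊖ s) (⊖-< j s))) ⟩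
    Σ< N (λ s → y s * (d * g (j ⊖ s)))       ≡⟨ Σ<-cong N (λ s _ → x∙yz≈y∙xz (y s) d (g (j ⊖ s))) ⟩
    Σ< N (λ s → d * (y s * g (j ⊖ s)))       ≡⟨ Σ<-*ˡ N d _ ⟨
    d * Σ< N (λ s → y s * g (j ⊖ s))         ≡⟨ cong (d *_) (mul-apply y g j<N) ⟨
    d * mul N y g j                          ∎

  eigen-iterate : ∀ x → Eigen x → ∀ t → t ≤ n → x (n ∸ t) ≋ d ^ t * x n
  eigen-iterate x eigen zero    _     = ≋-reflexive (sym (ℤ.*-identityˡ (x n)))
  eigen-iterate x eigen (suc t) 1+t≤n = begin
    x (n ∸ suc t)          ≡⟨ cong x (pred-suc (s≤s (subst (_≤ n) n∸t≡1+w (ℕ.m∸n≤m n t)))) ⟨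
    x (pred (suc w))       ≡⟨ cong (x ∘ pred) n∸t≡1+w ⟨
    x (pred (n ∸ t))       ≈⟨ eigen (n ∸ t) (s≤s (ℕ.m∸n≤m n t)) ⟩
    d * x (n ∸ t)          ≈⟨ *-congˡ-≋ d (eigen-iterate x eigen t (ℕ.<⇒≤ 1+t≤n)) ⟩
    d * (d ^ t * x n)      ≡⟨ ℤ.*-assoc d (d ^ t) (x n) ⟨
    d ^ suc t * x n        ∎
    where
    w = n ∸ suc t
    n∸t≡1+w : n ∸ t ≡ suc w
    n∸t≡1+w = ℕ.+-∸-assoc 1 1+t≤n

  eigen-determined : ∀ x → Eigen x → ∀ {j} → j < N → x j ≋ d ^ (n ∸ j) * x n
  eigen-determined x eigen {j} j<N =
    subst (λ i → x i ≋ d ^ (n ∸ j) * x n) (ℕ.m∸[m∸n]≡n (ℕ.≤-pred j<N)) (eigen-iterate x eigen (n ∸ j) (ℕ.m∸n≤m n j))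

  eigen-cycle : ∀ x → Eigen x → (d ^ N - 1ℤ) * x n ≋ 0ℤ
  eigen-cycle x eigen = subst (_≋ 0ℤ) (expand d (d ^ n) (x n)) (≋⇒-≋0 (≋-sym around))
    where
    expand : ∀ d e a → d * e * a - a ≡ (d * e - 1ℤ) * a
    expand = solve-∀
    around : x n ≋ d ^ N * x n
    around = begin
      x n                  ≡⟨ cong x pred-zero ⟨
      x (pred 0)           ≈⟨ eigen 0 (s≤s z≤n) ⟩
      d * x 0              ≈⟨ *-congˡ-≋ d (eigen-determined x eigen (s≤s z≤n)) ⟩
      d * (d ^ n * x n)    ≡⟨ ℤ.*-assoc d (d ^ n) (x n) ⟨
      d ^ N * x n          ∎

  scaled-Q0-eigen : ∀ c → c * (d ^ N - 1ℤ) ≋ 0ℤ → Eigen (c · Q0 N d)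
  scaled-Q0-eigen c c[d^N-1]≋0 zero _ = begin
    c * Q0 N d (pred 0)    ≡⟨ cong (λ t → c * Q0 N d t) pred-zero ⟩
    c * Q0 N d n           ≡⟨ cong (c *_) (trans (Q0-apply d ℕ.≤-refl) (cong (d ^_) (ℕ.n∸n≡0 n))) ⟩
    c * 1ℤ                 ≡⟨ ℤ.*-identityʳ c ⟩
    c                      ≈⟨ -≋0⇒≋ (subst (_≋ 0ℤ) (expand c d (d ^ n)) c[d^N-1]≋0) ⟨
    c * (d * d ^ n)        ≡⟨ x∙yz≈y∙xz c d (d ^ n) ⟩
    d * (c * d ^ (n ∸ 0))  ≡⟨ cong (λ t → d * (c * t)) (Q0-apply d (s≤s z≤n)) ⟨
    d * (c * Q0 N d 0)     ∎
    where
    expand : ∀ c d e → c * (d * e - 1ℤ) ≡ c * (d * e) - c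
    expand = solve-∀
  scaled-Q0-eigen c _ (suc j) 1+j<N = begin
    c * Q0 N d (pred (suc j))     ≡⟨ cong (λ t → c * Q0 N d t) (pred-suc 1+j<N) ⟩
    c * Q0 N d j                  ≡⟨ cong (c *_) (Q0-apply d (ℕ.<-trans (ℕ.n<1+n j) 1+j<N)) ⟩
    c * d ^ (n ∸ j)               ≡⟨ cong (λ e → c * d ^ e) (ℕ.+-∸-assoc 1 (ℕ.≤-pred 1+j<N)) ⟩
    c * (d * d ^ (n ∸ suc j))     ≡⟨ x∙yz≈y∙xz c d (d ^ (n ∸ suc j)) ⟩
    d * (c * d ^ (n ∸ suc j))     ≡⟨ cong (λ t → d * (c * t)) (Q0-apply d 1+j<N) ⟨
    d * (c * Q0 N d (suc j))      ∎

module _ {p : ℕ} (p-prime : Prime p) where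
  private instance
    p≢0 : NonZero p
    p≢0 = prime⇒nonZero p-prime

  p^m∣a*b∧p∤b⇒p^m∣a : ∀ m {a b} → ¬ p ℕ.∣ b → p ^ℕ m ℕ.∣ a *ℕ b → p ^ℕ m ℕ.∣ a
  p^m∣a*b∧p∤b⇒p^m∣a zero    {a} _ _ = ℕ.1∣ a
  p^m∣a*b∧p∤b⇒p^m∣a (suc m) {a} {b} p∤b p^[1+m]∣ab
    with p^m∣a*b∧p∤b⇒p^m∣a m {a} p∤b (ℕ.∣-trans (ℕ.n∣m*n p) p^[1+m]∣ab)
  ... | ℕ.divides q refl with euclidsLemma q b p-prime p∣qb
    where
    instance
      p^m≢0 : NonZero (p ^ℕ m)
      p^m≢0 = ℕ.m^n≢0 p m
    *-right-comm : ∀ a b c → a *ℕ b *ℕ c ≡ a *ℕ c *ℕ b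
    *-right-comm = ℕ-Solver.solve-∀
    p∣qb : p ℕ.∣ q *ℕ b
    p∣qb = ℕ.*-cancelʳ-∣ (p ^ℕ m) (subst (p ^ℕ suc m ℕ.∣_) (*-right-comm q (p ^ℕ m) b) p^[1+m]∣ab)
  ... | inj₁ p∣q = ℕ.*-monoˡ-∣ (p ^ℕ m) p∣q
  ... | inj₂ p∣b = ⊥-elim (p∤b p∣b)

  minimal-exponent-∣ : ∀ m k {D x} → p ^ℕ m ℕ.∣ D *ℕ x →
    (∀ v → v < k → ¬ p ^ℕ m ℕ.∣ p ^ℕ v *ℕ D) → p ^ℕ k ℕ.∣ x
  minimal-exponent-∣ m k {D} {x} p^m∣Dx minimal = go k ℕ.≤-refl
    where
    rearrange : ∀ a b c → a *ℕ (b *ℕ c) ≡ c *ℕ a *ℕ b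
    rearrange = ℕ-Solver.solve-∀
    go : ∀ j → j ≤ k → p ^ℕ j ℕ.∣ x
    go zero    _     = ℕ.1∣ x
    go (suc j) 1+j≤k with go j (ℕ.<⇒≤ 1+j≤k)
    ... | ℕ.divides q refl with p ℕ.∣? q
    ...   | yes (ℕ.divides r refl) = ℕ.divides r (ℕ.*-assoc r p (p ^ℕ j))
    ...   | no p∤q = ⊥-elim (minimal j 1+j≤k (p^m∣a*b∧p∤b⇒p^m∣a m p∤q
              (subst (p ^ℕ m ℕ.∣_) (rearrange D q (p ^ℕ j)) p^m∣Dx)))

  minimal-exponent-∣ℤ : ∀ m k {D x : ℤ} → + (p ^ℕ m) ∣ D * x →
    (∀ v → v < k → ¬ + (p ^ℕ m) ∣ + (p ^ℕ v) * D) → + (p ^ℕ k) ∣ x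
  minimal-exponent-∣ℤ m k {D} {x} p^m∣Dx minimal =
    minimal-exponent-∣ m k (subst (p ^ℕ m ℕ.∣_) (ℤ.abs-* D x) p^m∣Dx)
      (λ v v<k → minimal v v<k ∘ subst (p ^ℕ m ℕ.∣_) (sym (ℤ.abs-* (+ (p ^ℕ v)) D)))

σ-minus-annihilator : ∀ {p} m k N .{{_ : NonZero N}} → Prime p → (d : ℤ) →
  (+ (p ^ℕ m)) ∣ ((+ (p ^ℕ k)) * ((d ^ N) - 1ℤ)) →
  (∀ v → v < k → ¬ ((+ (p ^ℕ m)) ∣ ((+ (p ^ℕ v)) * ((d ^ N) - 1ℤ)))) →
  (x : Elem) →
    (Ann (p ^ℕ m) N (σ-minus N d) x → InIdeal (p ^ℕ m) N ((+ (p ^ℕ k)) · Q0 N d) x)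
    × (InIdeal (p ^ℕ m) N ((+ (p ^ℕ k)) · Q0 N d) x → Ann (p ^ℕ m) N (σ-minus N d) x)
σ-minus-annihilator {p} m k (suc n) p-prime d p^m∣p^k[d^N-1] minimal x = ann⇒ideal , ideal⇒ann
  where
  open Cyclic n
  open GroupRing n
  open Congruence (p ^ℕ m)
  open Eigen (p ^ℕ m) n d
  open SetoidReasoning ≋-setoid

  ann⇒ideal : Ann (p ^ℕ m) N (σ-minus N d) x → InIdeal (p ^ℕ m) N ((+ (p ^ℕ k)) · Q0 N d) x
  ann⇒ideal ann = mono N 0 c , λ j j<N → ≋-toᵤ (x≋c·generator j<N)
    where
    eigen = ann⇒eigen x ann
    p^k∣xₙ : + (p ^ℕ k) Signed.∣ x n
    p^k∣xₙ = Signed.∣ᵤ⇒∣ (minimal-exponent-∣ℤ p-prime m k (Signed.∣⇒∣ᵤ (≋0⇒∣ (eigen-cycle x eigen))) minimal)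
    open Signed._∣_ p^k∣xₙ renaming (quotient to c; equality to xₙ≡c*p^k)
    x≋c·generator : ∀ {j} → j < N → x j ≋ mul N (mono N 0 c) ((+ (p ^ℕ k)) · Q0 N d) j
    x≋c·generator {j} j<N = begin
      x j                                ≈⟨ eigen-determined x eigen j<N ⟩
      d ^ (n ∸ j) * x n                  ≡⟨ cong (d ^ (n ∸ j) *_) xₙ≡c*p^k ⟩
      d ^ (n ∸ j) * (c * + (p ^ℕ k))     ≡⟨ rearrange (d ^ (n ∸ j)) c (+ (p ^ℕ k)) ⟩
      c * (+ (p ^ℕ k) * d ^ (n ∸ j))     ≡⟨ cong (λ t → c * (+ (p ^ℕ k) * t)) (Q0-apply d j<N) ⟨
      c * (+ (p ^ℕ k) * Q0 N d j)        ≡⟨ mono₀-mul c _ j<N ⟨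
      mul N (mono N 0 c) ((+ (p ^ℕ k)) · Q0 N d) j ∎
      where
      rearrange : ∀ e c q → e * (c * q) ≡ c * (q * e)
      rearrange = solve-∀

  ideal⇒ann : InIdeal (p ^ℕ m) N ((+ (p ^ℕ k)) · Q0 N d) x → Ann (p ^ℕ m) N (σ-minus N d) x
  ideal⇒ann (y , x≈y*generator) = eigen⇒ann x (eigen-resp x _ x≈y*generator
    (eigen-mulˡ y _ (scaled-Q0-eigen (+ (p ^ℕ k)) (∣⇒≋0 (Signed.∣ᵤ⇒∣ p^m∣p^k[d^N-1])))))

lemma2p6 : (p n m i : ℕ) → Prime p → i ≤ n →
    (d : ℤ) → (+ p) ∣ (d - 1ℤ) →
    (k : ℕ) →
    (+ (p ^ℕ m)) ∣ ((+ (p ^ℕ k)) * ((d ^ (p ^ℕ i)) - 1ℤ)) →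
    (∀ v → v < k → ¬ ((+ (p ^ℕ m)) ∣ ((+ (p ^ℕ v)) * ((d ^ (p ^ℕ i)) - 1ℤ)))) →
    (x : Elem) →
      (Ann (p ^ℕ m) (p ^ℕ i) (σ-minus (p ^ℕ i) d) x
        → InIdeal (p ^ℕ m) (p ^ℕ i) ((+ (p ^ℕ k)) · Q0 (p ^ℕ i) d) x)
      × (InIdeal (p ^ℕ m) (p ^ℕ i) ((+ (p ^ℕ k)) · Q0 (p ^ℕ i) d) x
        → Ann (p ^ℕ m) (p ^ℕ i) (σ-minus (p ^ℕ i) d) x)
lemma2p6 p n m i p-prime _ d _ k =
  σ-minus-annihilator m k (p ^ℕ i) {{ℕ.m^n≢0 p i {{prime⇒nonZero p-prime}}}} p-prime d
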